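{- Let $p$ be a prime and let $q=p^\alpha$ with $\alpha>0$ an integer. Let $k\geq 2$ be an integer. Let $L\subseteq\{0,1,\ldots,q-1\}$ be a proper subset with $|L|=s>0$. Let $n$ be a positive integer and let $\mathcal F\subseteq 2^{[n]}$ be a family of subsets of $[n]$ such that for every $F\in\mathcal F$, $|F|\not\equiv \ell\pmod q$ for all $\ell\in L$, and such that for any $k$ distinct sets $F_1,\ldots,F_k\in\mathcal F$ there exists $\ell\in L$ with $|F_1\cap\cdots\cap F_k|\equiv \ell\pmod q$. Suppose moreover that there is an integer $t\leq q-1$ such that for each $F\in\mathcal F$, $|F|\equiv r\pmod q$ for some $r\in\{q-t,\ldots,q-1\}$. Then $$|\mathcal F|\leq (k-1)\sum_{j=q-t}^{q-1}\binom{n}{j}.$$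
   Context: $2^{[n]}$ denotes the family of all subsets of $[n]=\{1,\ldots,n\}$. -}

module Defs where

open import Data.Nat.Base using (ℕ; zero; suc; _+_; _∸_; ∣_-_∣)
open import Data.Nat.Divisibility using (_∣_)
open import Data.Nat.Combinatorics using (_C_)
open import Data.List.Base using (map; upTo)
open import Data.Nat.ListAction using (sum)
open import Data.Fin.Base using (Fin)
open import Data.Fin.Subset using (Subset; _∩_; ⊤)
import Data.Vec.Functional as VF

_≡_[mod_] : ℕ → ℕ → ℕ → Set
a ≡ b [mod q ] = q ∣ ∣ a - b ∣

⋂ : ∀ {n k} → (Fin k → Subset n) → Subset n
⋂ F = VF.foldr _∩_ ⊤ F

binomSum : ℕ → ℕ → ℕ → ℕ
binomSum n q t = sum (map (λ i → n C (q ∸ t + i)) (upTo t))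

-- Write r(F) = |F| mod q.  Pick F ∈ 𝓕 and intersect it with further members G
-- as long as |G ∩ D| ≡ r(F) for the running intersection D.  Once k - 1 sets are used, the
-- k-wise condition and r(F) ∉ L forbid further such G; so discarding the at most k - 1 sets
-- used and repeating gives pairs (D_i, F_i), at least |𝓕| / (k - 1) of them, with
-- |F_i ∩ D_i| ≡ r(F_i) but |F_j ∩ D_i| ≢ r(F_i) for j > i.
-- Since p divides C(q, i) for 0 < i < q, the number C(x + q - 1 - r, q - 1) is prime to p
-- exactly when x ≡ r (mod q).  For r ≥ q - t, Vandermonde's identity writes it,
-- at x = |F ∩ D|, as a dot product of a vector of D with the vector (𝟙[T ⊆ F])_T indexed by
-- the sets T with q - t ≤ |T| ≤ q - 1.  The pairs (D_i, F_i) thus give a triangular system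
-- over 𝔽_p, and Gaussian elimination bounds its size by the number of such T.

module Submission where

open import Defs
open import Data.Nat.Base using (ℕ; _*_; _^_; _≤_; _<_; _∸_)
open import Data.Nat.Primality using (Prime)
open import Data.Fin.Base using (Fin)
open import Data.Fin.Subset using (Subset; ∣_∣)
open import Data.List.Base using (List; length)
open import Data.List.Membership.Propositional using (_∈_)
open import Data.List.Relation.Unary.All using (All)
open import Data.List.Relation.Unary.Unique.Propositional using (Unique)
open import Data.Product using (Σ; ∃; _×_)
open import Relation.Binary.PropositionalEquality using (_≡_)
open import Relation.Nullary using (¬_)

open import Data.Bool.Base using (true; false)
open import Data.Bool.Properties using () renaming (_≟_ to _≟ᵇ_)
open import Data.Nat.Base
open import Data.Nat.Properties
import Algebra.Properties.CommutativeSemigroup as CommutativeSemigroupProperties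
open CommutativeSemigroupProperties +-commutativeSemigroup using (interchange; x∙yz≈y∙xz; xy∙z≈xz∙y)
open import Data.Nat.Combinatorics using (_C_; nCk+nC[k+1]≡[n+1]C[k+1]; nCn≡1; nC1≡n)
open import Data.Nat.Combinatorics.Specification using (k>n⇒nCk≡0)
open import Data.Nat.Divisibility
open import Data.Nat.DivMod
open import Data.Nat.ListAction using (sum)
open import Data.Nat.ListAction.Properties using (sum-++)
open import Data.Nat.Primality using (euclidsLemma; prime⇒nonZero; ¬prime[1])
open import Data.Nat.Solver using (module +-*-Solver)
open import Data.Fin.Base using (zero; suc)
open import Data.Fin.Subset using (_∩_; ⊤)
open import Data.Fin.Subset.Properties using (∩-identityʳ; ∩-assoc; ∩-comm; ∩-idem)
open import Data.Vec.Base using ([]; _∷_)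
open import Data.Vec.Properties using (≡-dec)
open import Data.List.Base using ([]; _∷_; _++_; map; lookup; removeAt; foldr; filter; upTo)
open import Data.List.Properties
  using (map-++; map-∘; map-cong; map-applyUpTo; length-map; length-++; length-removeAt′; length-filter; filter-all)
open import Data.List.Membership.Propositional using (_∉_; find)
open import Data.List.Membership.Propositional.Properties using (∈-lookup; ∈-filter⁻)
open import Data.List.Relation.Binary.Subset.Propositional using (_⊆_)
open import Data.List.Relation.Unary.All as All using ([]; _∷_)
open import Data.List.Relation.Unary.All.Properties using (map⁺; ¬Any⇒All¬)
open import Data.List.Relation.Unary.AllPairs using ([]; _∷_)
open import Data.List.Relation.Unary.Any using (here; there; any?)
open import Data.List.Relation.Unary.Unique.Propositional.Properties using (filter⁺)
open import Data.Product using (_,_; proj₁; proj₂)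
open import Data.Sum using (inj₁; inj₂)
open import Data.Unit using (tt) renaming (⊤ to Unit)
open import Data.Empty using (⊥-elim)
open import Function.Base using (_∘_; id)
open import Function.Bundles using (_⇔_; mk⇔; Equivalence)
open import Function.Properties.Equivalence using () renaming (trans to ⇔-trans; sym to ⇔-sym)
open import Relation.Nullary using (yes; no; ¬?)
open import Relation.Binary.Definitions using (DecidableEquality)
open import Relation.Binary.PropositionalEquality

open +-*-Solver

-- Binomial convolution

infixl 7 _⋆_

_⋆_ : (ℕ → ℕ) → (ℕ → ℕ) → ℕ → ℕ
(f ⋆ g) zero    = f 0 * g 0
(f ⋆ g) (suc j) = f 0 * g (suc j) + ((f ∘ suc) ⋆ g) j

⋆-congˡ : ∀ {f f′} g → f ≗ f′ → f ⋆ g ≗ f′ ⋆ g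
⋆-congˡ g f≗f′ zero    = cong (_* g 0) (f≗f′ 0)
⋆-congˡ g f≗f′ (suc j) = cong₂ _+_ (cong (_* g (suc j)) (f≗f′ 0)) (⋆-congˡ g (f≗f′ ∘ suc) j)

⋆-distribʳ-+ : ∀ f f′ g j → ((λ i → f i + f′ i) ⋆ g) j ≡ (f ⋆ g) j + (f′ ⋆ g) j
⋆-distribʳ-+ f f′ g zero    = *-distribʳ-+ (g 0) (f 0) (f′ 0)
⋆-distribʳ-+ f f′ g (suc j)
  rewrite ⋆-distribʳ-+ (f ∘ suc) (f′ ∘ suc) g j | *-distribʳ-+ (g (suc j)) (f 0) (f′ 0) =
  interchange (f 0 * g (suc j)) (f′ 0 * g (suc j)) (((f ∘ suc) ⋆ g) j) (((f′ ∘ suc) ⋆ g) j)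

⋆-zeroˡ : ∀ {f} g → (∀ i → f i ≡ 0) → ∀ j → (f ⋆ g) j ≡ 0
⋆-zeroˡ {f} g f≡0 zero    rewrite f≡0 0 = refl
⋆-zeroˡ {f} g f≡0 (suc j) rewrite f≡0 0 = ⋆-zeroˡ g (f≡0 ∘ suc) j

⋆-identityˡ : ∀ g → (0 C_) ⋆ g ≗ g
⋆-identityˡ g zero    = +-identityʳ (g 0)
⋆-identityˡ g (suc j) = begin
  1 * g (suc j) + (((0 C_) ∘ suc) ⋆ g) j ≡⟨ cong (1 * g (suc j) +_) (⋆-zeroˡ g (λ _ → refl) j) ⟩
  1 * g (suc j) + 0                      ≡⟨ trans (+-identityʳ _) (*-identityˡ _) ⟩
  g (suc j)                              ∎
  where open ≡-Reasoning

vandermonde : ∀ a b → (a C_) ⋆ (b C_) ≗ (a + b) C_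
vandermonde zero    b j       = ⋆-identityˡ (b C_) j
vandermonde (suc a) b zero    = refl
vandermonde (suc a) b (suc j) = begin
  1 * g (suc j) + (((suc a C_) ∘ suc) ⋆ g) j
    ≡⟨ cong (1 * g (suc j) +_) (⋆-congˡ g (sym ∘ nCk+nC[k+1]≡[n+1]C[k+1] a) j) ⟩
  1 * g (suc j) + ((λ i → a C i + a C suc i) ⋆ g) j
    ≡⟨ cong (1 * g (suc j) +_) (⋆-distribʳ-+ (a C_) ((a C_) ∘ suc) g j) ⟩
  1 * g (suc j) + (((a C_) ⋆ g) j + (((a C_) ∘ suc) ⋆ g) j)
    ≡⟨ x∙yz≈y∙xz (1 * g (suc j)) (((a C_) ⋆ g) j) _ ⟩
  ((a C_) ⋆ g) j + ((a C_) ⋆ g) (suc j)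
    ≡⟨ cong₂ _+_ (vandermonde a b j) (vandermonde a b (suc j)) ⟩
  (a + b) C j + (a + b) C suc j
    ≡⟨ nCk+nC[k+1]≡[n+1]C[k+1] (a + b) j ⟩
  suc (a + b) C suc j ∎
  where
  open ≡-Reasoning
  g : ℕ → ℕ
  g = b C_

⋆-shift : ∀ f g s u → (∀ v → u < v → g v ≡ 0) → (f ⋆ g) (s + u) ≡ ((f ∘ (s +_)) ⋆ g) u
⋆-shift f g zero    u g≡0 = refl
⋆-shift f g (suc s) u g≡0 rewrite g≡0 (suc (s + u)) (s≤s (m≤n+m u s)) | *-zeroʳ (f 0) =
  ⋆-shift (f ∘ suc) g s u g≡0

∣-⋆ : ∀ {d} f g j → (∀ i → i ≤ j → d ∣ f i) → d ∣ (f ⋆ g) j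
∣-⋆ f g zero    d∣f = ∣m⇒∣m*n (g 0) (d∣f 0 z≤n)
∣-⋆ f g (suc j) d∣f =
  ∣m∣n⇒∣m+n (∣m⇒∣m*n (g (suc j)) (d∣f 0 z≤n)) (∣-⋆ (f ∘ suc) g j (λ i i≤j → d∣f (suc i) (s≤s i≤j)))

-- Binomial coefficients modulo a prime power

[1+k]*[1+n]C[1+k]≡[1+n]*nCk : ∀ n k → suc k * (suc n C suc k) ≡ suc n * (n C k)
[1+k]*[1+n]C[1+k]≡[1+n]*nCk zero    zero    = refl
[1+k]*[1+n]C[1+k]≡[1+n]*nCk zero    (suc k) = *-zeroʳ (suc (suc k))
[1+k]*[1+n]C[1+k]≡[1+n]*nCk (suc n) zero    =
  trans (*-identityˡ _) (trans (nC1≡n (suc (suc n))) (sym (*-identityʳ _)))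
[1+k]*[1+n]C[1+k]≡[1+n]*nCk (suc n) (suc k) = begin
  suc (suc k) * (suc (suc n) C suc (suc k))
    ≡⟨ cong (suc (suc k) *_) (nCk+nC[k+1]≡[n+1]C[k+1] (suc n) (suc k)) ⟨
  suc (suc k) * (X + suc n C suc (suc k))
    ≡⟨ *-distribˡ-+ (suc (suc k)) X _ ⟩
  (X + suc k * X) + suc (suc k) * (suc n C suc (suc k))
    ≡⟨ cong₂ (λ a b → (X + a) + b) ([1+k]*[1+n]C[1+k]≡[1+n]*nCk n k)
                                   ([1+k]*[1+n]C[1+k]≡[1+n]*nCk n (suc k)) ⟩
  (X + suc n * (n C k)) + suc n * (n C suc k)
    ≡⟨ trans (+-assoc X _ _) (cong (X +_) (sym (*-distribˡ-+ (suc n) (n C k) (n C suc k)))) ⟩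
  X + suc n * (n C k + n C suc k)
    ≡⟨ cong (λ c → X + suc n * c) (nCk+nC[k+1]≡[n+1]C[k+1] n k) ⟩
  suc (suc n) * X ∎
  where
  open ≡-Reasoning
  X : ℕ
  X = suc n C suc k

∣m+n⇔∣m : ∀ {d m n} → d ∣ n → (d ∣ m + n) ⇔ (d ∣ m)
∣m+n⇔∣m {d} {m} {n} d∣n =
  mk⇔ (λ d∣m+n → ∣m+n∣m⇒∣n (subst (d ∣_) (+-comm m n) d∣m+n) d∣n) (λ d∣m → ∣m∣n⇒∣m+n d∣m d∣n)

module _ {p} (p-prime : Prime p) where

  private instance
    p≢0 : NonZero p
    p≢0 = prime⇒nonZero p-prime

  p^α∣m*n⇒p^α∣m : ∀ α m {n} → ¬ p ∣ n → p ^ α ∣ m * n → p ^ α ∣ m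
  p^α∣m*n⇒p^α∣m zero    m p∤n _ = 1∣ m
  p^α∣m*n⇒p^α∣m (suc α) m {n} p∤n p^[1+α]∣m*n
    with euclidsLemma m n p-prime (m*n∣⇒m∣ p (p ^ α) p^[1+α]∣m*n)
  ... | inj₂ p∣n = ⊥-elim (p∤n p∣n)
  ... | inj₁ (divides m′ refl) = subst (p * p ^ α ∣_) (*-comm p m′) (*-monoʳ-∣ p p^α∣m′)
    where
    p^α∣m′ : p ^ α ∣ m′
    p^α∣m′ = p^α∣m*n⇒p^α∣m α m′ p∤n (*-cancelˡ-∣ p (subst (p * p ^ α ∣_)
      (solve 3 (λ m p n → m :* p :* n := p :* (m :* n)) refl m′ p n) p^[1+α]∣m*n))

  p∣[p^α]Ci : ∀ α {i} → 0 < i → i < p ^ α → p ∣ p ^ α C i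
  p∣[p^α]Ci α {suc i} _ i<p^α with p ∣? (p ^ α C suc i)
  ... | yes p∣ = p∣
  ... | no  p∤ = ⊥-elim (<⇒≱ i<p^α (∣⇒≤ (p^α∣m*n⇒p^α∣m α (suc i) p∤ p^α∣[1+i]*[p^α]C[1+i])))
    where
    Q : ℕ
    Q = pred (p ^ α)
    p^α∣[1+i]*[p^α]C[1+i] : p ^ α ∣ suc i * (p ^ α C suc i)
    p^α∣[1+i]*[p^α]C[1+i] = subst (λ q → q ∣ suc i * (q C suc i)) (suc-pred (p ^ α) {{m^n≢0 p α}})
      (divides (Q C i) (trans ([1+k]*[1+n]C[1+k]≡[1+n]*nCk Q i) (*-comm (suc Q) (Q C i))))

module BinomialResidues {p} (p-prime : Prime p) (Q : ℕ) (p∣qCi : ∀ {i} → 0 < i → i < suc Q → p ∣ suc Q C i)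
  where

  q : ℕ
  q = suc Q

  p∣[z+q]Cj⇔p∣zCj : ∀ z {j} → j < q → (p ∣ (z + q) C j) ⇔ (p ∣ z C j)
  p∣[z+q]Cj⇔p∣zCj z {zero}  _   = mk⇔ id id
  p∣[z+q]Cj⇔p∣zCj z {suc j} j<q = subst (λ c → (p ∣ c) ⇔ (p ∣ z C suc j)) [z+q]C[1+j]
    (⇔-trans (∣m+n⇔∣m p∣tail) (mk⇔ (subst (p ∣_) (*-identityˡ _)) (subst (p ∣_) (sym (*-identityˡ _)))))
    where
    tail : ℕ
    tail = (((q C_) ∘ suc) ⋆ (z C_)) j
    p∣tail : p ∣ tail
    p∣tail = ∣-⋆ ((q C_) ∘ suc) (z C_) j (λ i i≤j → p∣qCi (s≤s z≤n) (≤-<-trans (s≤s i≤j) j<q))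
    [z+q]C[1+j] : 1 * (z C suc j) + tail ≡ (z + q) C suc j
    [z+q]C[1+j] = trans (vandermonde q z (suc j)) (cong (_C suc j) (+-comm q z))

  p∣[z+k*q]Cj⇔p∣zCj : ∀ z k {j} → j < q → (p ∣ (z + k * q) C j) ⇔ (p ∣ z C j)
  p∣[z+k*q]Cj⇔p∣zCj z zero    {j} _   =
    subst (λ y → (p ∣ y C j) ⇔ (p ∣ z C j)) (sym (+-identityʳ z)) (mk⇔ id id)
  p∣[z+k*q]Cj⇔p∣zCj z (suc k) {j} j<q =
    subst (λ y → (p ∣ y C j) ⇔ (p ∣ z C j))
      (solve 3 (λ z k q → (z :+ k :* q) :+ q := z :+ (con 1 :+ k) :* q) refl z k q)
      (⇔-trans (p∣[z+q]Cj⇔p∣zCj (z + k * q) j<q) (p∣[z+k*q]Cj⇔p∣zCj z k j<q))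

  p∣zCQ⇔z%q≢Q : ∀ z → (p ∣ z C Q) ⇔ (z % q ≢ Q)
  p∣zCQ⇔z%q≢Q z = subst (λ y → (p ∣ y C Q) ⇔ (z % q ≢ Q)) (sym (m≡m%n+[m/n]*n z q))
    (⇔-trans (p∣[z+k*q]Cj⇔p∣zCj (z % q) (z / q) ≤-refl) (p∣rCQ⇔r≢Q (z % q) (m%n<n z q)))
    where
    p∤1 : ¬ p ∣ 1
    p∤1 p∣1 = ¬prime[1] (subst Prime (∣1⇒≡1 p∣1) p-prime)
    p∣rCQ⇔r≢Q : ∀ r → r < q → (p ∣ r C Q) ⇔ (r ≢ Q)
    p∣rCQ⇔r≢Q r r<q = mk⇔ (λ { p∣QCQ refl → p∤1 (subst (p ∣_) (nCn≡1 Q) p∣QCQ) })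
      (λ r≢Q → subst (p ∣_) (sym (k>n⇒nCk≡0 (≤∧≢⇒< (s≤s⁻¹ r<q) r≢Q))) (p ∣0))

  [x+Q∸r]%q≡Q⇔x%q≡r : ∀ x {r} → r ≤ Q → (x + (Q ∸ r)) % q ≡ Q ⇔ x % q ≡ r
  [x+Q∸r]%q≡Q⇔x%q≡r x {r} r≤Q = mk⇔ to from
    where
    open ≡-Reasoning
    Q≡r+[Q∸r] : Q ≡ r + (Q ∸ r)
    Q≡r+[Q∸r] = sym (m+[n∸m]≡n r≤Q)
    to : (x + (Q ∸ r)) % q ≡ Q → x % q ≡ r
    to z%q≡Q = begin
      x % q           ≡⟨ cong (_% q) x≡r+s*q ⟩
      (r + s * q) % q ≡⟨ [m+kn]%n≡m%n r s q ⟩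
      r % q           ≡⟨ m<n⇒m%n≡m (s≤s r≤Q) ⟩
      r               ∎
      where
      s : ℕ
      s = (x + (Q ∸ r)) / q
      x≡r+s*q : x ≡ r + s * q
      x≡r+s*q = +-cancelʳ-≡ (Q ∸ r) x (r + s * q) (begin
        x + (Q ∸ r)               ≡⟨ m≡m%n+[m/n]*n (x + (Q ∸ r)) q ⟩
        (x + (Q ∸ r)) % q + s * q ≡⟨ cong (_+ s * q) (trans z%q≡Q Q≡r+[Q∸r]) ⟩
        r + (Q ∸ r) + s * q       ≡⟨ xy∙z≈xz∙y r (Q ∸ r) (s * q) ⟩
        r + s * q + (Q ∸ r)       ∎)
    from : x % q ≡ r → (x + (Q ∸ r)) % q ≡ Q
    from x%q≡r = begin
      (x + (Q ∸ r)) % q             ≡⟨ cong (λ c → (c + (Q ∸ r)) % q) (m≡m%n+[m/n]*n x q) ⟩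
      (x % q + s * q + (Q ∸ r)) % q ≡⟨ cong (_% q) (xy∙z≈xz∙y (x % q) (s * q) (Q ∸ r)) ⟩
      (x % q + (Q ∸ r) + s * q) % q ≡⟨ [m+kn]%n≡m%n (x % q + (Q ∸ r)) s q ⟩
      (x % q + (Q ∸ r)) % q         ≡⟨ cong (λ c → (c + (Q ∸ r)) % q) x%q≡r ⟩
      (r + (Q ∸ r)) % q             ≡⟨ cong (_% q) Q≡r+[Q∸r] ⟨
      Q % q                         ≡⟨ m<n⇒m%n≡m ≤-refl ⟩
      Q                             ∎
      where
      s : ℕ
      s = x / q

  p∣[x+Q∸r]CQ⇔x%q≢r : ∀ x {r} → r ≤ Q → (p ∣ (x + (Q ∸ r)) C Q) ⇔ (x % q ≢ r)
  p∣[x+Q∸r]CQ⇔x%q≢r x {r} r≤Q = ⇔-trans (p∣zCQ⇔z%q≢Q (x + (Q ∸ r)))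
    (mk⇔ (λ z%q≢Q → z%q≢Q ∘ from) (λ x%q≢r → x%q≢r ∘ to))
    where open Equivalence ([x+Q∸r]%q≡Q⇔x%q≡r x r≤Q)

-- Triangular systems over 𝔽_p

∑ : {A : Set} → List A → (A → ℕ) → ℕ
∑ xs f = sum (map f xs)

infix 5 ∑
syntax ∑ xs (λ x → e) = ∑[ x ∈ xs ] e

module _ {A : Set} where

  ∑-++ : ∀ (xs ys : List A) f → ∑ (xs ++ ys) f ≡ ∑ xs f + ∑ ys f
  ∑-++ xs ys f = trans (cong sum (map-++ f xs ys)) (sum-++ (map f xs) (map f ys))

  ∑-map : ∀ {B : Set} (g : A → B) xs f → ∑ (map g xs) f ≡ ∑ xs (f ∘ g)
  ∑-map g xs f = cong sum (sym (map-∘ xs))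

  ∑-cong : ∀ (xs : List A) {f g} → f ≗ g → ∑ xs f ≡ ∑ xs g
  ∑-cong xs f≗g = cong sum (map-cong f≗g xs)

  ∑-zero : ∀ (xs : List A) → ∑[ x ∈ xs ] 0 ≡ 0
  ∑-zero []       = refl
  ∑-zero (x ∷ xs) = ∑-zero xs

  ∑-*ˡ : ∀ c (xs : List A) f → ∑[ x ∈ xs ] c * f x ≡ c * ∑ xs f
  ∑-*ˡ c []       f = sym (*-zeroʳ c)
  ∑-*ˡ c (x ∷ xs) f = trans (cong (c * f x +_) (∑-*ˡ c xs f)) (sym (*-distribˡ-+ c (f x) _))

  ∑-linear : ∀ a b (xs : List A) f g → ∑[ x ∈ xs ] (a * f x + b * g x) ≡ a * ∑ xs f + b * ∑ xs g
  ∑-linear a b []       f g = sym (cong₂ _+_ (*-zeroʳ a) (*-zeroʳ b))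
  ∑-linear a b (x ∷ xs) f g rewrite ∑-linear a b xs f g =
    solve 6 (λ a b u v s t → (a :* u :+ b :* v) :+ (a :* s :+ b :* t) := a :* (u :+ s) :+ b :* (v :+ t))
      refl a b (f x) (g x) (∑ xs f) (∑ xs g)

  ∑-removeAt : ∀ (xs : List A) i f → ∑ xs f ≡ f (lookup xs i) + ∑ (removeAt xs i) f
  ∑-removeAt (x ∷ xs) zero    f = refl
  ∑-removeAt (x ∷ xs) (suc i) f =
    trans (cong (f x +_) (∑-removeAt xs i f)) (x∙yz≈y∙xz (f x) (f (lookup xs i)) (∑ (removeAt xs i) f))

dot : {I : Set} → List I → (I → ℕ) → (I → ℕ) → ℕ
dot ds x y = ∑[ d ∈ ds ] x d * y d

module TriangularSystems {p} (p-prime : Prime p) {I : Set} where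

  private instance
    p≢0 : NonZero p
    p≢0 = prime⇒nonZero p-prime

  Triangular : List I → List ((I → ℕ) × (I → ℕ)) → Set
  Triangular ds []              = Unit
  Triangular ds ((x , y) ∷ xys) =
    ¬ p ∣ dot ds x y × All (λ (_ , y′) → p ∣ dot ds x y′) xys × Triangular ds xys

  pivot : ∀ (ds : List I) x y → ¬ p ∣ dot ds x y → ∃ λ (i : Fin (length ds)) → ¬ p ∣ x (lookup ds i)
  pivot []       x y p∤x·y = ⊥-elim (p∤x·y (p ∣0))
  pivot (d ∷ ds) x y p∤x·y with p ∣? x d
  ... | no  p∤xd = zero , p∤xd
  ... | yes p∣xd with pivot ds x y (p∤x·y ∘ ∣m∣n⇒∣m+n (∣m⇒∣m*n (y d) p∣xd))
  ...   | i , p∤xi = suc i , p∤xi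

  p∣c*m⇔p∣m : ∀ {c m} → ¬ p ∣ c → (p ∣ c * m) ⇔ (p ∣ m)
  p∣c*m⇔p∣m {c} {m} p∤c = mk⇔ p∣c*m⇒p∣m (∣n⇒∣m*n c)
    where
    p∣c*m⇒p∣m : p ∣ c * m → p ∣ m
    p∣c*m⇒p∣m p∣c*m with euclidsLemma c m p-prime p∣c*m
    ... | inj₁ p∣c = ⊥-elim (p∤c p∣c)
    ... | inj₂ p∣m = p∣m

  module Elimination (ds : List I) (i : Fin (length ds)) (x₀ : I → ℕ) where

    d₀ : I
    d₀ = lookup ds i

    c : ℕ
    c = x₀ d₀

    -- p ∸ 1 plays the role of -1: the d₀-coordinate of eliminate x is p * (x d₀ * c).
    eliminate : (I → ℕ) → I → ℕ
    eliminate x d = c * x d + (p ∸ 1) * x d₀ * x₀ d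

    dot-eliminate : ∀ x y → dot (removeAt ds i) (eliminate x) y + p * (x d₀ * c * y d₀)
                            ≡ c * dot ds x y + (p ∸ 1) * x d₀ * dot ds x₀ y
    dot-eliminate x y = begin
      dot (removeAt ds i) (eliminate x) y + p * (x d₀ * c * y d₀)
        ≡⟨ cong (dot (removeAt ds i) (eliminate x) y +_) eliminate-d₀ ⟨
      dot (removeAt ds i) (eliminate x) y + eliminate x d₀ * y d₀
        ≡⟨ +-comm _ (eliminate x d₀ * y d₀) ⟩
      eliminate x d₀ * y d₀ + dot (removeAt ds i) (eliminate x) y
        ≡⟨ ∑-removeAt ds i (λ d → eliminate x d * y d) ⟨
      dot ds (eliminate x) y
        ≡⟨ ∑-cong ds (λ d → solve 5 (λ c x e x₀ y → (c :* x :+ e :* x₀) :* y := c :* (x :* y) :+ e :* (x₀ :* y))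
                                     refl c (x d) ((p ∸ 1) * x d₀) (x₀ d) (y d)) ⟩
      ∑[ d ∈ ds ] (c * (x d * y d) + (p ∸ 1) * x d₀ * (x₀ d * y d))
        ≡⟨ ∑-linear c ((p ∸ 1) * x d₀) ds (λ d → x d * y d) (λ d → x₀ d * y d) ⟩
      c * dot ds x y + (p ∸ 1) * x d₀ * dot ds x₀ y ∎
      where
      open ≡-Reasoning
      eliminate-d₀ : eliminate x d₀ * y d₀ ≡ p * (x d₀ * c * y d₀)
      eliminate-d₀ = begin
        (c * x d₀ + (p ∸ 1) * x d₀ * c) * y d₀
          ≡⟨ solve 4 (λ c x p′ y → (c :* x :+ p′ :* x :* c) :* y := (con 1 :+ p′) :* (x :* c :* y))
                     refl c (x d₀) (p ∸ 1) (y d₀) ⟩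
        suc (p ∸ 1) * (x d₀ * c * y d₀)
          ≡⟨ cong (_* (x d₀ * c * y d₀)) (suc-pred p) ⟩
        p * (x d₀ * c * y d₀) ∎

    p∣dot-eliminate⇔p∣dot : ¬ p ∣ c → ∀ x y → p ∣ dot ds x₀ y →
      (p ∣ dot (removeAt ds i) (eliminate x) y) ⇔ (p ∣ dot ds x y)
    p∣dot-eliminate⇔p∣dot p∤c x y p∣x₀·y =
      ⇔-trans (⇔-sym (∣m+n⇔∣m (m∣m*n (x d₀ * c * y d₀))))
      (⇔-trans (mk⇔ (subst (p ∣_) (dot-eliminate x y)) (subst (p ∣_) (sym (dot-eliminate x y))))
      (⇔-trans (∣m+n⇔∣m (∣n⇒∣m*n ((p ∸ 1) * x d₀) p∣x₀·y)) (p∣c*m⇔p∣m p∤c)))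

    eliminate-triangular : ¬ p ∣ c → ∀ xys → Triangular ds xys → All (λ (_ , y) → p ∣ dot ds x₀ y) xys →
      Triangular (removeAt ds i) (map (λ (x , y) → eliminate x , y) xys)
    eliminate-triangular p∤c []              _                          []                 = tt
    eliminate-triangular p∤c ((x , y) ∷ xys) (p∤x·y , p∣x·ys , x·y-tri) (p∣x₀·y ∷ p∣x₀·ys) =
      p∤x·y ∘ to (p∣dot-eliminate⇔p∣dot p∤c x y p∣x₀·y) ,
      map⁺ (All.zipWith (λ (p∣x·y′ , p∣x₀·y′) → from (p∣dot-eliminate⇔p∣dot p∤c x _ p∣x₀·y′) p∣x·y′)
                        (p∣x·ys , p∣x₀·ys)) ,
      eliminate-triangular p∤c xys x·y-tri p∣x₀·ys
      where open Equivalence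

  triangular⇒length≤ : ∀ (ds : List I) xys → Triangular ds xys → length xys ≤ length ds
  triangular⇒length≤ ds = bound (length ds) ds refl
    where
    -- Recursion on the dimension D, since removeAt ds i is not structurally smaller than ds.
    bound : ∀ D (ds : List I) → length ds ≡ D → ∀ xys → Triangular ds xys → length xys ≤ D
    bound D       ds      _        []                _                          = z≤n
    bound zero    []      _        (_ ∷ _)           (p∤0 , _)                  = ⊥-elim (p∤0 (p ∣0))
    bound zero    (_ ∷ _) ()
    bound (suc D) ds      ∣ds∣≡1+D ((x₀ , y₀) ∷ xys) (p∤x₀·y₀ , p∣x₀·ys , tri) with pivot ds x₀ y₀ p∤x₀·y₀
    ... | i , p∤c = s≤s (subst (_≤ D) (length-map _ xys)
      (bound D (removeAt ds i) ∣ds∖i∣≡D _ (eliminate-triangular p∤c xys tri p∣x₀·ys)))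
      where
      open Elimination ds i x₀ using (eliminate-triangular)
      ∣ds∖i∣≡D : length (removeAt ds i) ≡ D
      ∣ds∖i∣≡D = suc-injective (trans (sym (length-removeAt′ ds i)) ∣ds∣≡1+D)

-- Subsets and the polynomial vectors

𝟙[_⊆_] : ∀ {n} → Subset n → Subset n → ℕ
𝟙[ []        ⊆ []        ] = 1
𝟙[ false ∷ T ⊆ _     ∷ B ] = 𝟙[ T ⊆ B ]
𝟙[ true  ∷ T ⊆ true  ∷ B ] = 𝟙[ T ⊆ B ]
𝟙[ true  ∷ T ⊆ false ∷ B ] = 0

𝟙[T⊆A]*𝟙[T⊆B]≡𝟙[T⊆B∩A] : ∀ {n} (T A B : Subset n) → 𝟙[ T ⊆ A ] * 𝟙[ T ⊆ B ] ≡ 𝟙[ T ⊆ B ∩ A ]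
𝟙[T⊆A]*𝟙[T⊆B]≡𝟙[T⊆B∩A] []          []          []          = refl
𝟙[T⊆A]*𝟙[T⊆B]≡𝟙[T⊆B∩A] (false ∷ T) (_     ∷ A) (_     ∷ B) = 𝟙[T⊆A]*𝟙[T⊆B]≡𝟙[T⊆B∩A] T A B
𝟙[T⊆A]*𝟙[T⊆B]≡𝟙[T⊆B∩A] (true  ∷ T) (true  ∷ A) (true  ∷ B) = 𝟙[T⊆A]*𝟙[T⊆B]≡𝟙[T⊆B∩A] T A B
𝟙[T⊆A]*𝟙[T⊆B]≡𝟙[T⊆B∩A] (true  ∷ T) (true  ∷ A) (false ∷ B) = *-zeroʳ 𝟙[ T ⊆ A ]
𝟙[T⊆A]*𝟙[T⊆B]≡𝟙[T⊆B∩A] (true  ∷ T) (false ∷ A) (true  ∷ B) = refl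
𝟙[T⊆A]*𝟙[T⊆B]≡𝟙[T⊆B∩A] (true  ∷ T) (false ∷ A) (false ∷ B) = refl

subsetsOfSize : ∀ n → ℕ → List (Subset n)
subsetsOfSize zero    zero    = [] ∷ []
subsetsOfSize zero    (suc j) = []
subsetsOfSize (suc n) zero    = map (false ∷_) (subsetsOfSize n zero)
subsetsOfSize (suc n) (suc j) = map (false ∷_) (subsetsOfSize n (suc j)) ++ map (true ∷_) (subsetsOfSize n j)

length-subsetsOfSize : ∀ n j → length (subsetsOfSize n j) ≡ n C j
length-subsetsOfSize zero    zero    = refl
length-subsetsOfSize zero    (suc j) = refl
length-subsetsOfSize (suc n) zero    =
  trans (length-map (false ∷_) (subsetsOfSize n zero)) (length-subsetsOfSize n zero)
length-subsetsOfSize (suc n) (suc j) = begin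
  length (map (false ∷_) (subsetsOfSize n (suc j)) ++ map (true ∷_) (subsetsOfSize n j))
    ≡⟨ length-++ (map (false ∷_) (subsetsOfSize n (suc j))) ⟩
  length (map (false ∷_) (subsetsOfSize n (suc j))) + length (map (true ∷_) (subsetsOfSize n j))
    ≡⟨ cong₂ _+_ (length-map (false ∷_) (subsetsOfSize n (suc j))) (length-map (true ∷_) (subsetsOfSize n j)) ⟩
  length (subsetsOfSize n (suc j)) + length (subsetsOfSize n j)
    ≡⟨ cong₂ _+_ (length-subsetsOfSize n (suc j)) (length-subsetsOfSize n j) ⟩
  n C suc j + n C j
    ≡⟨ +-comm (n C suc j) (n C j) ⟩
  n C j + n C suc j
    ≡⟨ nCk+nC[k+1]≡[n+1]C[k+1] n j ⟩
  suc n C suc j ∎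
  where open ≡-Reasoning

∑-subsetsOfSize-suc : ∀ n j f → ∑ (subsetsOfSize (suc n) (suc j)) f
                                ≡ ∑ (subsetsOfSize n (suc j)) (f ∘ (false ∷_)) + ∑ (subsetsOfSize n j) (f ∘ (true ∷_))
∑-subsetsOfSize-suc n j f =
  trans (∑-++ (map (false ∷_) (subsetsOfSize n (suc j))) (map (true ∷_) (subsetsOfSize n j)) f)
        (cong₂ _+_ (∑-map (false ∷_) (subsetsOfSize n (suc j)) f) (∑-map (true ∷_) (subsetsOfSize n j) f))

∑-𝟙[⊆B]≡∣B∣Cj : ∀ n j (B : Subset n) → ∑[ T ∈ subsetsOfSize n j ] 𝟙[ T ⊆ B ] ≡ ∣ B ∣ C j
∑-𝟙[⊆B]≡∣B∣Cj zero    zero    []          = refl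
∑-𝟙[⊆B]≡∣B∣Cj zero    (suc j) []          = refl
∑-𝟙[⊆B]≡∣B∣Cj (suc n) zero    (b ∷ B)     =
  trans (∑-map (false ∷_) (subsetsOfSize n zero) 𝟙[_⊆ b ∷ B ]) (∑-𝟙[⊆B]≡∣B∣Cj n zero B)
∑-𝟙[⊆B]≡∣B∣Cj (suc n) (suc j) (true ∷ B)  = begin
  ∑[ T ∈ subsetsOfSize (suc n) (suc j) ] 𝟙[ T ⊆ true ∷ B ]
    ≡⟨ ∑-subsetsOfSize-suc n j (𝟙[_⊆ true ∷ B ]) ⟩
  (∑[ T ∈ subsetsOfSize n (suc j) ] 𝟙[ T ⊆ B ]) + (∑[ T ∈ subsetsOfSize n j ] 𝟙[ T ⊆ B ])
    ≡⟨ cong₂ _+_ (∑-𝟙[⊆B]≡∣B∣Cj n (suc j) B) (∑-𝟙[⊆B]≡∣B∣Cj n j B) ⟩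
  ∣ B ∣ C suc j + ∣ B ∣ C j
    ≡⟨ +-comm (∣ B ∣ C suc j) _ ⟩
  ∣ B ∣ C j + ∣ B ∣ C suc j
    ≡⟨ nCk+nC[k+1]≡[n+1]C[k+1] ∣ B ∣ j ⟩
  suc ∣ B ∣ C suc j ∎
  where open ≡-Reasoning
∑-𝟙[⊆B]≡∣B∣Cj (suc n) (suc j) (false ∷ B) = begin
  ∑[ T ∈ subsetsOfSize (suc n) (suc j) ] 𝟙[ T ⊆ false ∷ B ]
    ≡⟨ ∑-subsetsOfSize-suc n j (𝟙[_⊆ false ∷ B ]) ⟩
  (∑[ T ∈ subsetsOfSize n (suc j) ] 𝟙[ T ⊆ B ]) + (∑[ T ∈ subsetsOfSize n j ] 0)
    ≡⟨ cong₂ _+_ (∑-𝟙[⊆B]≡∣B∣Cj n (suc j) B) (∑-zero (subsetsOfSize n j)) ⟩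
  ∣ B ∣ C suc j + 0
    ≡⟨ +-identityʳ _ ⟩
  ∣ B ∣ C suc j ∎
  where open ≡-Reasoning

sizedSubsets : ∀ n → ℕ → ℕ → List (ℕ × Subset n)
sizedSubsets n s zero    = []
sizedSubsets n s (suc c) = map (s ,_) (subsetsOfSize n s) ++ sizedSubsets n (suc s) c

∑-upTo-suc : ∀ c f → ∑ (upTo (suc c)) f ≡ f 0 + ∑ (upTo c) (f ∘ suc)
∑-upTo-suc c f =
  cong (λ xs → f 0 + sum xs) (trans (map-applyUpTo suc f c) (sym (map-applyUpTo id (f ∘ suc) c)))

length-sizedSubsets : ∀ n s c → length (sizedSubsets n s c) ≡ ∑[ i ∈ upTo c ] n C (s + i)
length-sizedSubsets n s zero    = refl
length-sizedSubsets n s (suc c) = begin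
  length (map (s ,_) (subsetsOfSize n s) ++ sizedSubsets n (suc s) c)
    ≡⟨ length-++ (map (s ,_) (subsetsOfSize n s)) ⟩
  length (map (s ,_) (subsetsOfSize n s)) + length (sizedSubsets n (suc s) c)
    ≡⟨ cong₂ _+_ (trans (length-map (s ,_) (subsetsOfSize n s)) (length-subsetsOfSize n s))
                 (length-sizedSubsets n (suc s) c) ⟩
  n C s + (∑[ i ∈ upTo c ] n C (suc s + i))
    ≡⟨ cong₂ _+_ (cong (n C_) (sym (+-identityʳ s))) (∑-cong (upTo c) (λ i → cong (n C_) (sym (+-suc s i)))) ⟩
  n C (s + 0) + (∑[ i ∈ upTo c ] n C (s + suc i))
    ≡⟨ ∑-upTo-suc c (λ i → n C (s + i)) ⟨
  ∑[ i ∈ upTo (suc c) ] n C (s + i) ∎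
  where open ≡-Reasoning

-- The coefficients of the multilinear polynomial x ↦ C(|x ∩ D| + m, Q) in the monomials
-- x ↦ 𝟙[T ⊆ x], where T is tagged with its size j: by Vandermonde,
-- C(|x ∩ D| + m, Q) = ∑_j C(m, Q - j) C(|x ∩ D|, j).
coefficients : ∀ {n} → ℕ → Subset n → ℕ → ℕ × Subset n → ℕ
coefficients Q D m (j , T) = 𝟙[ T ⊆ D ] * (m C (Q ∸ j))

monomials : ∀ {n} → Subset n → ℕ × Subset n → ℕ
monomials F (_ , T) = 𝟙[ T ⊆ F ]

module _ {n} (Q m : ℕ) (D F : Subset n) where

  private
    b : ℕ
    b = ∣ F ∩ D ∣

    Q∸s≡u : ∀ {s u} → s + u ≡ Q → Q ∸ s ≡ u
    Q∸s≡u {s} {u} s+u≡Q = trans (cong (_∸ s) (sym s+u≡Q)) (m+n∸m≡n s u)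

  dot-layer : ∀ j → dot (map (j ,_) (subsetsOfSize n j)) (coefficients Q D m) (monomials F)
                    ≡ (m C (Q ∸ j)) * (∣ F ∩ D ∣ C j)
  dot-layer j = begin
    dot (map (j ,_) (subsetsOfSize n j)) (coefficients Q D m) (monomials F)
      ≡⟨ ∑-map (j ,_) (subsetsOfSize n j) _ ⟩
    ∑[ T ∈ subsetsOfSize n j ] 𝟙[ T ⊆ D ] * w * 𝟙[ T ⊆ F ]
      ≡⟨ ∑-cong (subsetsOfSize n j) (λ T →
           trans (CommutativeSemigroupProperties.xy∙z≈y∙xz *-commutativeSemigroup 𝟙[ T ⊆ D ] w 𝟙[ T ⊆ F ])
                 (cong (w *_) (𝟙[T⊆A]*𝟙[T⊆B]≡𝟙[T⊆B∩A] T D F))) ⟩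
    ∑[ T ∈ subsetsOfSize n j ] w * 𝟙[ T ⊆ F ∩ D ]
      ≡⟨ ∑-*ˡ w (subsetsOfSize n j) 𝟙[_⊆ F ∩ D ] ⟩
    w * (∑[ T ∈ subsetsOfSize n j ] 𝟙[ T ⊆ F ∩ D ])
      ≡⟨ cong (w *_) (∑-𝟙[⊆B]≡∣B∣Cj n j (F ∩ D)) ⟩
    w * (b C j) ∎
    where
    open ≡-Reasoning
    w : ℕ
    w = m C (Q ∸ j)

  dot-sizedSubsets : ∀ s u → s + u ≡ Q → dot (sizedSubsets n s (suc u)) (coefficients Q D m) (monomials F)
                                         ≡ ((λ i → ∣ F ∩ D ∣ C (s + i)) ⋆ (m C_)) u
  dot-sizedSubsets s zero s+0≡Q = begin
    dot (map (s ,_) (subsetsOfSize n s) ++ []) (coefficients Q D m) (monomials F)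
      ≡⟨ ∑-++ (map (s ,_) (subsetsOfSize n s)) [] _ ⟩
    dot (map (s ,_) (subsetsOfSize n s)) (coefficients Q D m) (monomials F) + 0
      ≡⟨ trans (+-identityʳ _) (dot-layer s) ⟩
    (m C (Q ∸ s)) * (b C s)
      ≡⟨ cong (λ k → (m C k) * (b C s)) (Q∸s≡u {s} {0} s+0≡Q) ⟩
    (m C 0) * (b C s)
      ≡⟨ *-comm (m C 0) (b C s) ⟩
    (b C s) * (m C 0)
      ≡⟨ cong (λ k → (b C k) * (m C 0)) (+-identityʳ s) ⟨
    (b C (s + 0)) * (m C 0) ∎
    where open ≡-Reasoning
  dot-sizedSubsets s (suc u) s+1+u≡Q = begin
    dot (map (s ,_) (subsetsOfSize n s) ++ sizedSubsets n (suc s) (suc u)) (coefficients Q D m) (monomials F)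
      ≡⟨ ∑-++ (map (s ,_) (subsetsOfSize n s)) (sizedSubsets n (suc s) (suc u)) _ ⟩
    dot (map (s ,_) (subsetsOfSize n s)) (coefficients Q D m) (monomials F)
      + dot (sizedSubsets n (suc s) (suc u)) (coefficients Q D m) (monomials F)
      ≡⟨ cong₂ _+_ (dot-layer s) (dot-sizedSubsets (suc s) u (trans (sym (+-suc s u)) s+1+u≡Q)) ⟩
    (m C (Q ∸ s)) * (b C s) + ((λ i → b C (suc s + i)) ⋆ (m C_)) u
      ≡⟨ cong₂ _+_ (trans (cong (λ k → (m C k) * (b C s)) (Q∸s≡u {s} {suc u} s+1+u≡Q)) (*-comm (m C suc u) (b C s)))
                   (⋆-congˡ (m C_) (λ i → cong (b C_) (sym (+-suc s i))) u) ⟩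
    (b C s) * (m C suc u) + ((λ i → b C (s + suc i)) ⋆ (m C_)) u
      ≡⟨ cong (λ k → (b C k) * (m C suc u) + ((λ i → b C (s + suc i)) ⋆ (m C_)) u) (+-identityʳ s) ⟨
    (b C (s + 0)) * (m C suc u) + ((λ i → b C (s + suc i)) ⋆ (m C_)) u ∎
    where open ≡-Reasoning

  dot-coefficients-monomials : ∀ {s u} → s + u ≡ Q → m ≤ u →
    dot (sizedSubsets n s (suc u)) (coefficients Q D m) (monomials F) ≡ (∣ F ∩ D ∣ + m) C Q
  dot-coefficients-monomials {s} {u} s+u≡Q m≤u = begin
    dot (sizedSubsets n s (suc u)) (coefficients Q D m) (monomials F)
      ≡⟨ dot-sizedSubsets s u s+u≡Q ⟩
    ((λ i → b C (s + i)) ⋆ (m C_)) u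
      ≡⟨ ⋆-shift (b C_) (m C_) s u (λ v u<v → k>n⇒nCk≡0 (≤-<-trans m≤u u<v)) ⟨
    ((b C_) ⋆ (m C_)) (s + u)
      ≡⟨ vandermonde b m (s + u) ⟩
    (b + m) C (s + u)
      ≡⟨ cong ((b + m) C_) s+u≡Q ⟩
    (b + m) C Q ∎
    where open ≡-Reasoning

-- Residues modulo q and the greedy separation

module _ {q : ℕ} .{{_ : NonZero q}} where

  ∣∸⇒%≡% : ∀ {a b} → b ≤ a → q ∣ a ∸ b → a % q ≡ b % q
  ∣∸⇒%≡% {a} {b} b≤a (divides s a∸b≡s*q) = begin
    a % q             ≡⟨ cong (_% q) (m+[n∸m]≡n b≤a) ⟨
    (b + (a ∸ b)) % q ≡⟨ cong (λ x → (b + x) % q) a∸b≡s*q ⟩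
    (b + s * q) % q   ≡⟨ [m+kn]%n≡m%n b s q ⟩
    b % q             ∎
    where open ≡-Reasoning

  ≡[mod]⇒%≡% : ∀ {a b} → a ≡ b [mod q ] → a % q ≡ b % q
  ≡[mod]⇒%≡% {a} {b} q∣∣a-b∣ with ≤-total a b
  ... | inj₁ a≤b = sym (∣∸⇒%≡% a≤b (subst (q ∣_) (m≤n⇒∣m-n∣≡n∸m a≤b) q∣∣a-b∣))
  ... | inj₂ b≤a = ∣∸⇒%≡% b≤a (subst (q ∣_) (trans (∣-∣-comm a b) (m≤n⇒∣m-n∣≡n∸m b≤a)) q∣∣a-b∣)

  ≡[mod]⇒%≡ : ∀ {a b} → a ≡ b [mod q ] → b < q → a % q ≡ b
  ≡[mod]⇒%≡ a≡b b<q = trans (≡[mod]⇒%≡% a≡b) (m<n⇒m%n≡m b<q)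

  %≡⇒≡[mod] : ∀ {a b} → a % q ≡ b → a ≡ b [mod q ]
  %≡⇒≡[mod] {a} refl = divides (a / q) (begin
    ∣ a - a % q ∣                   ≡⟨ cong (λ x → ∣ x - a % q ∣) (m≡m%n+[m/n]*n a q) ⟩
    ∣ a % q + (a / q) * q - a % q ∣ ≡⟨ ∣-∣-comm (a % q + (a / q) * q) (a % q) ⟩
    ∣ a % q - a % q + (a / q) * q ∣ ≡⟨ ∣m-m+n∣≡n (a % q) ((a / q) * q) ⟩
    (a / q) * q                     ∎)
    where open ≡-Reasoning

intersection : ∀ {n} → List (Subset n) → Subset n
intersection = foldr _∩_ ⊤

⋂-lookup : ∀ {n} (Gs : List (Subset n)) → ⋂ (lookup Gs) ≡ intersection Gs
⋂-lookup []       = refl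
⋂-lookup (G ∷ Gs) = cong (G ∩_) (⋂-lookup Gs)

∈⇒∩-intersection : ∀ {n} {G : Subset n} {Gs} → G ∈ Gs → G ∩ intersection Gs ≡ intersection Gs
∈⇒∩-intersection {G = G} {G ∷ Gs} (here refl) =
  trans (sym (∩-assoc G G _)) (cong (_∩ intersection Gs) (∩-idem G))
∈⇒∩-intersection {G = G} {H ∷ Gs} (there G∈Gs) = begin
  G ∩ (H ∩ intersection Gs) ≡⟨ ∩-assoc G H _ ⟨
  (G ∩ H) ∩ intersection Gs ≡⟨ cong (_∩ intersection Gs) (∩-comm G H) ⟩
  (H ∩ G) ∩ intersection Gs ≡⟨ ∩-assoc H G _ ⟩
  H ∩ (G ∩ intersection Gs) ≡⟨ cong (H ∩_) (∈⇒∩-intersection G∈Gs) ⟩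
  H ∩ intersection Gs       ∎
  where open ≡-Reasoning

lookup-injective : ∀ {A : Set} {xs : List A} → Unique xs → ∀ i j → lookup xs i ≡ lookup xs j → i ≡ j
lookup-injective {xs = _ ∷ _} _                  zero    zero    _  = refl
lookup-injective {xs = _ ∷ _} (x∉xs ∷ _)         zero    (suc j) eq = ⊥-elim (All.lookup x∉xs (∈-lookup j) eq)
lookup-injective {xs = _ ∷ _} (x∉xs ∷ _)         (suc i) zero    eq = ⊥-elim (All.lookup x∉xs (∈-lookup i) (sym eq))
lookup-injective {xs = _ ∷ _} (_    ∷ xs-unique) (suc i) (suc j) eq = cong suc (lookup-injective xs-unique i j eq)

module _ {n q : ℕ} .{{_ : NonZero q}} {L : List ℕ} {𝓕 : List (Subset n)} (L<q : All (_< q) L) where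

  k-wise⇒residue∈L : ∀ {k} →
    ((G : Fin k → Subset n) → (∀ i → G i ∈ 𝓕) → (∀ i j → G i ≡ G j → i ≡ j) →
      ∃ λ ℓ → ℓ ∈ L × (∣ ⋂ G ∣ ≡ ℓ [mod q ])) →
    ∀ Gs → Unique Gs → All (_∈ 𝓕) Gs → length Gs ≡ k → ∣ intersection Gs ∣ % q ∈ L
  k-wise⇒residue∈L k-wise Gs Gs-distinct Gs⊆𝓕 refl
    with k-wise (lookup Gs) (All.lookup Gs⊆𝓕 ∘ ∈-lookup) (lookup-injective Gs-distinct)
  ... | ℓ , ℓ∈L , ⋂≡ℓ = subst (_∈ L) (sym (≡[mod]⇒%≡ ∩Gs≡ℓ (All.lookup L<q ℓ∈L))) ℓ∈L
    where
    ∩Gs≡ℓ : ∣ intersection Gs ∣ ≡ ℓ [mod q ]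
    ∩Gs≡ℓ = subst (λ D → ∣ D ∣ ≡ ℓ [mod q ]) (⋂-lookup Gs) ⋂≡ℓ

module _ {A : Set} (_≟_ : DecidableEquality A) where

  delete : A → List A → List A
  delete x = filter (λ y → ¬? (y ≟ x))

  length≤1+length-delete : ∀ x {xs} → Unique xs → length xs ≤ suc (length (delete x xs))
  length≤1+length-delete x {[]}     _                  = z≤n
  length≤1+length-delete x {y ∷ ys} (y∉ys ∷ ys-unique) with y ≟ x
  ... | yes refl = s≤s (≤-reflexive (sym (cong length (filter-all (λ y → ¬? (y ≟ x)) (All.map (_∘ sym) y∉ys)))))
  ... | no  _    = s≤s (length≤1+length-delete x ys-unique)

Separated : ∀ {n} (q : ℕ) .{{_ : NonZero q}} → List (Subset n × Subset n) → Set
Separated q []              = Unit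
Separated q ((D , F) ∷ DFs) =
  ∣ F ∩ D ∣ % q ≡ ∣ F ∣ % q × All (λ (_ , F′) → ∣ F′ ∩ D ∣ % q ≢ ∣ F ∣ % q) DFs × Separated q DFs

module Greedy {n q k : ℕ} .{{_ : NonZero q}} (2≤k : 2 ≤ k) {L : List ℕ} {𝓕 : List (Subset n)}
  (k-wise : ∀ Gs → Unique Gs → All (_∈ 𝓕) Gs → length Gs ≡ k → ∣ intersection Gs ∣ % q ∈ L)
  (residue∉L : ∀ {F} → F ∈ 𝓕 → ∣ F ∣ % q ∉ L)
  where

  _≟ˢ_ : DecidableEquality (Subset n)
  _≟ˢ_ = ≡-dec _≟ᵇ_

  module ChainsThrough {F : Subset n} (F∈𝓕 : F ∈ 𝓕) where

    r : ℕ
    r = ∣ F ∣ % q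

    Hits : Subset n → Subset n → Set
    Hits D G = ∣ G ∩ D ∣ % q ≡ r

    record Chain (Cs : List (Subset n)) : Set where
      field
        distinct : Unique Cs
        members  : All (_∈ 𝓕) Cs
        F∈Cs     : F ∈ Cs
        hits     : ∣ intersection Cs ∣ % q ≡ r

    Fresh : List (Subset n) → Subset n → Set
    Fresh Cs G = G ∈ 𝓕 × All (G ≢_) Cs

    record Cut (rest : List (Subset n)) (j : ℕ) : Set where
      field
        D              : Subset n
        rest′          : List (Subset n)
        F-hits         : Hits D F
        rest′-misses   : All (¬_ ∘ Hits D) rest′
        rest′⊆rest     : rest′ ⊆ rest
        rest′-distinct : Unique rest′
        rest′-shorter  : length rest′ ≤ length rest
        cost           : length rest ≤ j + length rest′

    stop : ∀ {Cs} rest j → Chain Cs → Unique rest → All (¬_ ∘ Hits (intersection Cs)) rest → Cut rest j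
    stop {Cs} rest j chain rest-distinct misses = record
      { D              = intersection Cs
      ; rest′          = rest
      ; F-hits         = trans (cong (λ D → ∣ D ∣ % q) (∈⇒∩-intersection F∈Cs)) hits
      ; rest′-misses   = misses
      ; rest′⊆rest     = id
      ; rest′-distinct = rest-distinct
      ; rest′-shorter  = ≤-refl
      ; cost           = m≤n+m (length rest) j
      }
      where open Chain chain

    cut-delete : ∀ {rest j} G → Unique rest → Cut (delete _≟ˢ_ G rest) j → Cut rest (suc j)
    cut-delete {rest} G rest-distinct c = record
      { D              = D
      ; rest′          = rest′
      ; F-hits         = F-hits
      ; rest′-misses   = rest′-misses
      ; rest′⊆rest     = proj₁ ∘ ∈-filter⁻ (λ H → ¬? (H ≟ˢ G)) ∘ rest′⊆rest
      ; rest′-distinct = rest′-distinct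
      ; rest′-shorter  = ≤-trans rest′-shorter (length-filter (λ H → ¬? (H ≟ˢ G)) rest)
      ; cost           = ≤-trans (length≤1+length-delete _≟ˢ_ G rest-distinct) (s≤s cost)
      }
      where open Cut c

    -- j sets may still join the chain before it has k - 1 members; a fresh set hitting a
    -- chain of k - 1 members would complete k sets whose intersection has residue r ∉ L.
    cut : ∀ j Cs rest → Chain Cs → length Cs + j ≡ k ∸ 1 → Unique rest → All (Fresh Cs) rest → Cut rest j
    cut zero Cs rest chain ∣Cs∣+0≡k-1 rest-distinct fresh = stop rest zero chain rest-distinct (All.map misses fresh)
      where
      open Chain chain
      ∣G∷Cs∣≡k : suc (length Cs) ≡ k
      ∣G∷Cs∣≡k = trans (cong suc (trans (sym (+-identityʳ _)) ∣Cs∣+0≡k-1)) (m+[n∸m]≡n (≤-trans (s≤s z≤n) 2≤k))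
      misses : ∀ {G} → Fresh Cs G → ¬ Hits (intersection Cs) G
      misses {G} (G∈𝓕 , G∉Cs) G-hits =
        residue∉L F∈𝓕 (subst (_∈ L) G-hits (k-wise (G ∷ Cs) (G∉Cs ∷ distinct) (G∈𝓕 ∷ members) ∣G∷Cs∣≡k))
    cut (suc j) Cs rest chain ∣Cs∣+1+j≡k-1 rest-distinct fresh
      with any? (λ G → ∣ G ∩ intersection Cs ∣ % q ≟ r) rest
    ... | no none = stop rest (suc j) chain rest-distinct (¬Any⇒All¬ rest none)
    ... | yes some with find some
    ...   | G , G∈rest , G-hits =
      cut-delete G rest-distinct (cut j (G ∷ Cs) (delete _≟ˢ_ G rest) chain′ ∣G∷Cs∣+j≡k-1 rest∖G-distinct fresh′)
      where
      open Chain chain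
      fresh-G : Fresh Cs G
      fresh-G = All.lookup fresh G∈rest
      chain′ : Chain (G ∷ Cs)
      chain′ = record { distinct = proj₂ fresh-G ∷ distinct ; members = proj₁ fresh-G ∷ members
                      ; F∈Cs = there F∈Cs ; hits = G-hits }
      ∣G∷Cs∣+j≡k-1 : suc (length Cs) + j ≡ k ∸ 1
      ∣G∷Cs∣+j≡k-1 = trans (sym (+-suc (length Cs) j)) ∣Cs∣+1+j≡k-1
      rest∖G-distinct : Unique (delete _≟ˢ_ G rest)
      rest∖G-distinct = filter⁺ (λ H → ¬? (H ≟ˢ G)) rest-distinct
      fresh′ : All (Fresh (G ∷ Cs)) (delete _≟ˢ_ G rest)
      fresh′ = All.tabulate λ H∈rest∖G →
        let H∈rest , H≢G = ∈-filter⁻ (λ H → ¬? (H ≟ˢ G)) H∈rest∖G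
            H∈𝓕 , H∉Cs  = All.lookup fresh H∈rest
        in H∈𝓕 , H≢G ∷ H∉Cs

  Separation : List (Subset n) → Set
  Separation 𝓖 = ∃ λ DFs → Separated q DFs × All (λ (_ , F) → F ∈ 𝓖) DFs × length 𝓖 ≤ (k ∸ 1) * length DFs

  separate : ∀ fuel 𝓖 → length 𝓖 ≤ fuel → Unique 𝓖 → All (_∈ 𝓕) 𝓖 → Separation 𝓖
  separate _          []         _                 _                        _                  = [] , tt , [] , z≤n
  separate (suc fuel) (F ∷ rest) (s≤s ∣rest∣≤fuel) (F∉rest ∷ rest-distinct) (F∈𝓕 ∷ rest⊆𝓕) =
    extend (separate fuel rest′ (≤-trans rest′-shorter ∣rest∣≤fuel) rest′-distinct
                     (All.tabulate (All.lookup rest⊆𝓕 ∘ rest′⊆rest)))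
    where
    open ChainsThrough F∈𝓕
    chain : Chain (F ∷ [])
    chain = record { distinct = [] ∷ [] ; members = F∈𝓕 ∷ [] ; F∈Cs = here refl
                   ; hits = cong (λ D → ∣ D ∣ % q) (∩-identityʳ F) }
    fresh : All (Fresh (F ∷ [])) rest
    fresh = All.zipWith (λ (G∈𝓕 , F≢G) → G∈𝓕 , (F≢G ∘ sym) ∷ []) (rest⊆𝓕 , F∉rest)
    open Cut (cut (k ∸ 2) (F ∷ []) rest chain (sym (+-∸-assoc 1 2≤k)) rest-distinct fresh)
    extend : Separation rest′ → Separation (F ∷ rest)
    extend (DFs , separated , DFs⊆rest′ , ∣rest′∣≤) =
      (D , F) ∷ DFs ,
      (F-hits , All.map (All.lookup rest′-misses) DFs⊆rest′ , separated) ,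
      here refl ∷ All.map (there ∘ rest′⊆rest) DFs⊆rest′ ,
      (begin
        suc (length rest)            ≤⟨ s≤s cost ⟩
        suc (k ∸ 2 + length rest′)   ≡⟨ cong (_+ length rest′) (+-∸-assoc 1 2≤k) ⟨
        k ∸ 1 + length rest′         ≤⟨ +-monoʳ-≤ (k ∸ 1) ∣rest′∣≤ ⟩
        k ∸ 1 + (k ∸ 1) * length DFs ≡⟨ *-suc (k ∸ 1) (length DFs) ⟨
        (k ∸ 1) * suc (length DFs)   ∎)
      where open ≤-Reasoning

-- From separated pairs to a triangular system

m∸n≤o⇒m∸o≤n : ∀ m n o → m ∸ n ≤ o → m ∸ o ≤ n
m∸n≤o⇒m∸o≤n m n o m∸n≤o =
  m≤n+o⇒m∸n≤o m o (≤-trans (m≤n+m∸n m n) (≤-trans (+-monoʳ-≤ n m∸n≤o) (≤-reflexive (+-comm n o))))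

module _ {p} (p-prime : Prime p) (Q : ℕ) (p∣qCi : ∀ {i} → 0 < i → i < suc Q → p ∣ suc Q C i) where

  open BinomialResidues p-prime Q p∣qCi
  open TriangularSystems p-prime

  polynomialPair : ∀ {n} → Subset n × Subset n → (ℕ × Subset n → ℕ) × (ℕ × Subset n → ℕ)
  polynomialPair (D , F) = coefficients Q D (Q ∸ ∣ F ∣ % q) , monomials F

  separated⇒triangular : ∀ {n} u → u ≤ Q → (DFs : List (Subset n × Subset n)) → Separated q DFs →
    All (λ (_ , F) → Q ∸ u ≤ ∣ F ∣ % q) DFs → Triangular (sizedSubsets n (Q ∸ u) (suc u)) (map polynomialPair DFs)
  separated⇒triangular u u≤Q []              _                                _                    = tt
  separated⇒triangular u u≤Q ((D , F) ∷ DFs) (F-hits , F′-misses , separated) (r-large ∷ rs-large) =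
    (λ p∣dot → to (p∣value ∣ F ∩ D ∣) (subst (p ∣_) (dot≡value F) p∣dot) F-hits) ,
    map⁺ (All.map (λ {(_ , F′)} F′-miss → subst (p ∣_) (sym (dot≡value F′)) (from (p∣value ∣ F′ ∩ D ∣) F′-miss))
                  F′-misses) ,
    separated⇒triangular u u≤Q DFs separated rs-large
    where
    open Equivalence
    r : ℕ
    r = ∣ F ∣ % q
    p∣value : ∀ x → (p ∣ (x + (Q ∸ r)) C Q) ⇔ (x % q ≢ r)
    p∣value x = p∣[x+Q∸r]CQ⇔x%q≢r x (s≤s⁻¹ (m%n<n ∣ F ∣ q))
    dot≡value : ∀ F′ → dot (sizedSubsets _ (Q ∸ u) (suc u)) (coefficients Q D (Q ∸ r)) (monomials F′)
                       ≡ (∣ F′ ∩ D ∣ + (Q ∸ r)) C Q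
    dot≡value F′ = dot-coefficients-monomials Q (Q ∸ r) D F′ (m∸n+n≡m u≤Q) (m∸n≤o⇒m∸o≤n Q u r r-large)

  separated⇒length≤binomSum : ∀ {n} t → t ≤ Q → (DFs : List (Subset n × Subset n)) → Separated q DFs →
    All (λ (_ , F) → q ∸ t ≤ ∣ F ∣ % q) DFs → length DFs ≤ binomSum n q t
  separated⇒length≤binomSum zero    _     []            _ _         = z≤n
  separated⇒length≤binomSum zero    _     ((_ , F) ∷ _) _ (q≤r ∷ _) = ⊥-elim (<⇒≱ (m%n<n ∣ F ∣ q) q≤r)
  separated⇒length≤binomSum {n} (suc u) 1+u≤Q DFs separated rs-large = begin
    length DFs                              ≡⟨ length-map polynomialPair DFs ⟨
    length (map polynomialPair DFs)         ≤⟨ triangular⇒length≤ _ _ triangular ⟩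
    length (sizedSubsets n (Q ∸ u) (suc u)) ≡⟨ length-sizedSubsets n (Q ∸ u) (suc u) ⟩
    binomSum n q (suc u)                    ∎
    where
    open ≤-Reasoning
    triangular : Triangular (sizedSubsets n (Q ∸ u) (suc u)) (map polynomialPair DFs)
    triangular = separated⇒triangular u (≤-trans (n≤1+n u) 1+u≤Q) DFs separated rs-large

theorem1p7 : (p α k : ℕ) → Prime p → 1 ≤ α → 2 ≤ k →
    (L : List ℕ) → Unique L → All (λ ℓ → ℓ < p ^ α) L →
    length L < p ^ α → 0 < length L →
    (n : ℕ) → 1 ≤ n →
    (𝓕 : List (Subset n)) → Unique 𝓕 →
    (∀ F → F ∈ 𝓕 → ∀ ℓ → ℓ ∈ L → ¬ (∣ F ∣ ≡ ℓ [mod p ^ α ])) →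
    ((G : Fin k → Subset n) → (∀ i → G i ∈ 𝓕) → (∀ i j → G i ≡ G j → i ≡ j) →
      ∃ λ ℓ → ℓ ∈ L × (∣ ⋂ G ∣ ≡ ℓ [mod p ^ α ])) →
    (t : ℕ) → t ≤ p ^ α ∸ 1 →
    (∀ F → F ∈ 𝓕 → ∃ λ r → p ^ α ∸ t ≤ r × r ≤ p ^ α ∸ 1 × (∣ F ∣ ≡ r [mod p ^ α ])) →
    length 𝓕 ≤ (k ∸ 1) * binomSum n (p ^ α) t
theorem1p7 p α k p-prime _ 2≤k L _ L<q _ _ n _ 𝓕 𝓕-distinct residue∉L k-wise t t≤Q residue-range
  with p ^ α | m^n>0 p {{prime⇒nonZero p-prime}} α | p∣[p^α]Ci p-prime α
... | suc Q | _ | p∣qCi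
  with Greedy.separate 2≤k (k-wise⇒residue∈L L<q k-wise) residue∉L′ (length 𝓕) 𝓕 ≤-refl 𝓕-distinct (All.tabulate id)
  where
  residue∉L′ : ∀ {F} → F ∈ 𝓕 → ∣ F ∣ % suc Q ∉ L
  residue∉L′ {F} F∈𝓕 r∈L = residue∉L F F∈𝓕 _ r∈L (%≡⇒≡[mod] {a = ∣ F ∣} refl)
...   | DFs , separated , DFs⊆𝓕 , ∣𝓕∣≤ =
  ≤-trans ∣𝓕∣≤ (*-monoʳ-≤ (k ∸ 1) (separated⇒length≤binomSum p-prime Q p∣qCi t t≤Q DFs separated residues-large))
  where
  residue-large : ∀ {F} → F ∈ 𝓕 → suc Q ∸ t ≤ ∣ F ∣ % suc Q
  residue-large {F} F∈𝓕 with residue-range F F∈𝓕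
  ... | r , q-t≤r , r≤Q , F≡r = subst (suc Q ∸ t ≤_) (sym (≡[mod]⇒%≡ {a = ∣ F ∣} F≡r (s≤s r≤Q))) q-t≤r
  residues-large : All (λ (_ , F) → suc Q ∸ t ≤ ∣ F ∣ % suc Q) DFs
  residues-large = All.map residue-large DFs⊆𝓕
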